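{- Let $G$ be a graph and let $T$ be a tree whose set of leaves is $V(G)$, with a weighting $f:E(T)\to\mathbb{Z}_{\ge 0}$ (zero weights allowed). If there exists an integer $k$ such that for all distinct $u,v\in V(G)$, $uv\in E(G)$ if and only if $d_f(u,v)\le k$, then $T$ is an unweighted leaf root of $G$.
   Context: For a tree $T$ with edge weighting $f$, $d_f(x,y)$ denotes the sum of the weights of the edges on the unique $x$–$y$ path of $T$. A weighted tree $(T,f)$ with $f:E(T)\to\mathbb{N}^+$ (positive integers) and leaf set $V(G)$ is a leaf root of $G$ if there is an integer $k$ such that for all distinct $u,v\in V(G)$, $uv\in E(G)$ iff $d_f(u,v)\le k$. An unweighted tree $T$ is an unweighted leaf root of $G$ if there exists a weighting $f:E(T)\to\mathbb{N}^+$ such that $(T,f)$ is a leaf root of $G$. -}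

module Defs where

open import Data.Nat using (ℕ; zero; suc; _+_; _≤_)
open import Data.Integer using (ℤ; +_) renaming (_≤_ to _≤ℤ_)
open import Data.Fin using (Fin)
open import Data.List using (List; []; _∷_)
open import Data.List.Relation.Unary.Unique.Propositional using (Unique)
open import Data.Product using (Σ; ∃; _×_; _,_)
open import Data.Empty using (⊥)
open import Relation.Nullary using (¬_)
open import Relation.Binary.PropositionalEquality using (_≡_; _≢_)
open import Function.Bundles using (_⇔_)
open import Function.Definitions using (Injective)

record Graph (n : ℕ) : Set₁ where
  field
    Adj   : Fin n → Fin n → Set
    sym   : ∀ {x y} → Adj x y → Adj y x
    irrefl : ∀ {x} → ¬ Adj x x
open Graph public

data Walk {n : ℕ} (G : Graph n) : Fin n → Fin n → Set where
  []  : ∀ {x} → Walk G x x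
  _∷_ : ∀ {x y z} → Adj G x y → Walk G y z → Walk G x z

vertices : ∀ {n} {G : Graph n} {x y : Fin n} → Walk G x y → List (Fin n)
vertices {x = x} []      = x ∷ []
vertices {x = x} (_ ∷ w) = x ∷ vertices w

len : ∀ {n} {G : Graph n} {x y : Fin n} → Walk G x y → ℕ
len []      = 0
len (_ ∷ w) = suc (len w)

record Path {n : ℕ} (G : Graph n) (x y : Fin n) : Set where
  constructor mkPath
  field
    walk     : Walk G x y
    distinct : Unique (vertices walk)
open Path public

Connected : ∀ {n} → Graph n → Set
Connected {n} G = ∀ (x y : Fin n) → Walk G x y

-- no cycle: an edge xy together with a path from y back to x of
-- length ≥ 2 would close a cycle.
Acyclic : ∀ {n} → Graph n → Set
Acyclic {n} G = ∀ {x y : Fin n} → Adj G x y → (p : Path G y x) → 2 ≤ len (walk p) → ⊥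

record Tree (m : ℕ) : Set₁ where
  field
    graph     : Graph m
    connected : Connected graph
    acyclic   : Acyclic graph
open Tree public

IsLeaf : ∀ {m} → Tree m → Fin m → Set
IsLeaf T x = Σ _ λ y → Adj (graph T) x y × (∀ z → Adj (graph T) x z → z ≡ y)

-- the leaf set of T is V(G) = Fin n, identified via an injective map ι
-- whose image is exactly the set of leaves of T
LeafSetIs : ∀ {m} (n : ℕ) → Tree m → (Fin n → Fin m) → Set
LeafSetIs {m} n T ι = Injective _≡_ _≡_ ι × (∀ (x : Fin m) → IsLeaf T x ⇔ (∃ λ v → ι v ≡ x))

-- an edge weighting: a symmetric function on pairs of vertices
-- (only values on edges of T matter)
record Weighting {m : ℕ} (T : Tree m) : Set where
  field
    w    : Fin m → Fin m → ℕ
    wsym : ∀ x y → w x y ≡ w y x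
open Weighting public

Positive : ∀ {m} {T : Tree m} → Weighting T → Set
Positive {T = T} f = ∀ x y → Adj (graph T) x y → 1 ≤ w f x y

weight : ∀ {m} {T : Tree m} → Weighting T → ∀ {x y} → Walk (graph T) x y → ℕ
weight f [] = 0
weight f (_∷_ {x} {y} _ p) = w f x y + weight f p

-- d_f(u,v) ≤ k, phrased via the (unique) u–v path of the tree
DistLe : ∀ {m} {T : Tree m} → Weighting T → Fin m → Fin m → ℤ → Set
DistLe {T = T} f x y k = ∀ (p : Path (graph T) x y) → + (weight f (walk p)) ≤ℤ k

LeafRootCond : ∀ {n m} (G : Graph n) (T : Tree m) (ι : Fin n → Fin m) → Weighting T → ℤ → Set
LeafRootCond {n} G T ι f k =
  ∀ (u v : Fin n) → u ≢ v → Adj G u v ⇔ DistLe f (ι u) (ι v) k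

IsLeafRoot : ∀ {n m} (G : Graph n) (T : Tree m) (ι : Fin n → Fin m) → Weighting T → Set
IsLeafRoot G T ι f = Positive f × (∃ λ k → LeafRootCond G T ι f k)

IsUnweightedLeafRoot : ∀ {n m} (G : Graph n) (T : Tree m) (ι : Fin n → Fin m) → Set
IsUnweightedLeafRoot G T ι = ∃ λ (g : Weighting T) → IsLeafRoot G T ι g

module Submission where

-- Rescale the (possibly zero) weighting f to
--     g(e) = N · f(e) + 1,   where N = m + 1 and m is the number of vertices of T.
-- Every weight of g is positive, and along any walk p
--     d_g(p) = N · d_f(p) + len(p).
-- A path of T visits distinct vertices, so len(p) < m < N: the term len(p)
-- is a "lowest digit" in base N that can never carry.  Hence, for a
-- threshold K ≥ 0,  d_f(p) ≤ K  iff  d_g(p) ≤ N · K + m,  while a negative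
-- threshold is never reached by either weighting.  So (T, g) realises the
-- same adjacency relation as (T, f) with the rescaled threshold.

open import Defs hiding (sym)
open import Data.Nat using (ℕ; suc; _+_; _*_; _≤_; _<_)
open import Data.Nat.Properties
open import Data.Nat.Tactic.RingSolver using (solve-∀)
open import Data.Fin using (Fin; zero; suc)
open import Data.Fin.Properties using (injective⇒≤)
open import Data.Integer using (ℤ; +_; -[1+_]; +≤+) renaming (_≤_ to _≤ℤ_)
open import Data.Product using (∃; _,_)
open import Data.List using (List; _∷_; length; lookup)
import Data.List.Relation.Unary.All as All
open import Data.List.Relation.Unary.AllPairs using (_∷_)
open import Data.List.Relation.Unary.Unique.Propositional using (Unique)
open import Data.List.Membership.Propositional.Properties using (∈-lookup)
open import Relation.Binary.PropositionalEquality
open import Relation.Nullary using (contradiction)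
open import Function.Bundles using (_⇔_; mk⇔; Equivalence)
open import Function.Definitions using (Injective)

unique⇒lookup-injective : ∀ {A : Set} {xs : List A} → Unique xs →
                          Injective _≡_ _≡_ (lookup xs)
unique⇒lookup-injective (_ ∷ _)      {zero}  {zero}  _  = refl
unique⇒lookup-injective (x∉xs ∷ _)   {zero}  {suc j} eq = contradiction eq (All.lookup x∉xs (∈-lookup j))
unique⇒lookup-injective (x∉xs ∷ _)   {suc i} {zero}  eq = contradiction (sym eq) (All.lookup x∉xs (∈-lookup i))
unique⇒lookup-injective (_ ∷ uniq)   {suc i} {suc j} eq = cong suc (unique⇒lookup-injective uniq eq)

unique⇒length≤ : ∀ {n} {xs : List (Fin n)} → Unique xs → length xs ≤ n
unique⇒length≤ uniq = injective⇒≤ (unique⇒lookup-injective uniq)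

length-vertices : ∀ {n} {G : Graph n} {x y} (p : Walk G x y) → length (vertices p) ≡ suc (len p)
length-vertices []      = refl
length-vertices (_ ∷ p) = cong suc (length-vertices p)

path-len< : ∀ {n} {G : Graph n} {x y} (p : Path G x y) → len (walk p) < n
path-len< p = subst (_≤ _) (length-vertices (walk p)) (unique⇒length≤ (distinct p))

-- Base-(m+1) comparison: a lowest digit r ≤ m never affects a comparison
-- against a threshold whose lowest digit is the maximal one, m.
digit-compare : ∀ m a K {r} → r ≤ m → (a ≤ K ⇔ suc m * a + r ≤ suc m * K + m)
digit-compare m a K {r} r≤m = mk⇔ scale-up scale-down
  where
  N = suc m

  scale-up : a ≤ K → N * a + r ≤ N * K + m
  scale-up a≤K = +-mono-≤ (*-monoʳ-≤ N a≤K) r≤m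

  scale-down : N * a + r ≤ N * K + m → a ≤ K
  scale-down le = ≤-pred (*-cancelˡ-< N a (suc K) (begin-strict
    N * a          ≤⟨ m≤m+n (N * a) r ⟩
    N * a + r      ≤⟨ le ⟩
    N * K + m      <⟨ +-monoʳ-< (N * K) (n<1+n m) ⟩
    N * K + N      ≡⟨ +-comm (N * K) N ⟩
    N + N * K      ≡⟨ *-suc N K ⟨
    N * suc K      ∎))
    where open ≤-Reasoning

rescale : ℕ → ℤ → ℤ
rescale m (+ K)    = + (suc m * K + m)
rescale m -[1+ j ] = -[1+ j ]

rescale-compare : ∀ m a k {r} → r ≤ m → (+ a ≤ℤ k ⇔ + (suc m * a + r) ≤ℤ rescale m k)
rescale-compare m a (+ K) r≤m = mk⇔
  (λ { (+≤+ a≤K) → +≤+ (Equivalence.to (digit-compare m a K r≤m) a≤K) })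
  (λ { (+≤+ le)  → +≤+ (Equivalence.from (digit-compare m a K r≤m) le) })
rescale-compare m a -[1+ j ] r≤m = mk⇔ (λ ()) (λ ())

module _ {m : ℕ} {T : Tree m} where

  scaled : ℕ → Weighting T → Weighting T
  scaled N f = record
    { w    = λ x y → N * w f x y + 1
    ; wsym = λ x y → cong (λ c → N * c + 1) (wsym f x y) }

  scaled-positive : ∀ N f → Positive (scaled N f)
  scaled-positive N f x y _ = m≤n+m 1 (N * w f x y)

  scaled-weight : ∀ N f {x y} (p : Walk (graph T) x y) →
                  weight (scaled N f) p ≡ N * weight f p + len p
  scaled-weight N f []                = sym (cong (_+ 0) (*-zeroʳ N))
  scaled-weight N f (_∷_ {x} {y} _ p) = begin
    N * w f x y + 1 + weight (scaled N f) p    ≡⟨ cong (λ c → N * w f x y + 1 + c) (scaled-weight N f p) ⟩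
    N * w f x y + 1 + (N * weight f p + len p) ≡⟨ regroup N (w f x y) (weight f p) (len p) ⟩
    N * (w f x y + weight f p) + suc (len p)   ∎
    where
    open ≡-Reasoning
    regroup : ∀ N a b r → N * a + 1 + (N * b + r) ≡ N * (a + b) + suc r
    regroup = solve-∀

  scaled-distLe : ∀ f k {x y} →
                  DistLe f x y k ⇔ DistLe (scaled (suc m) f) x y (rescale m k)
  scaled-distLe f k = mk⇔ (λ d p → Equivalence.to (compare p) (d p))
                          (λ d p → Equivalence.from (compare p) (d p))
    where
    compare : ∀ {x y} (p : Path (graph T) x y) →
              (+ weight f (walk p) ≤ℤ k ⇔ + weight (scaled (suc m) f) (walk p) ≤ℤ rescale m k)
    compare p rewrite scaled-weight (suc m) f (walk p) =
      rescale-compare m (weight f (walk p)) k (<⇒≤ (path-len< p))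

lemma1 : ∀ {n m : ℕ} (G : Graph n) (T : Tree m) (ι : Fin n → Fin m) →
    LeafSetIs n T ι →
    (f : Weighting T) →
    (∃ λ (k : ℤ) → LeafRootCond G T ι f k) →
    IsUnweightedLeafRoot G T ι
lemma1 {m = m} G T ι _ f (k , cond) =
  scaled (suc m) f , scaled-positive (suc m) f , rescale m k ,
  λ u v u≢v → mk⇔
    (λ uv → Equivalence.to   (scaled-distLe f k) (Equivalence.to   (cond u v u≢v) uv))
    (λ d  → Equivalence.from (cond u v u≢v) (Equivalence.from (scaled-distLe f k) d))
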